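{- Let $(F_i)_{i\in I}$ be a finite acyclic family of clause-sets such that no $F_i$ has a forced literal, i.e. $\bigcup_{i\in I}\mathrm{frl}(F_i)=\emptyset$. Then $\mathrm{frl}(\bigcup_{i\in I}F_i)=\emptyset$.
   Context: Clauses are finite sets of literals without complementary pairs; clause-sets are finite sets of clauses (CNF). $\varphi*F$ applies a partial assignment. $\mathrm{frl}(F)$ is the set of all literals $x$ such that $\langle x\to0\rangle*F$ is unsatisfiable (so every literal is in $\mathrm{frl}(F)$ if $F$ is unsatisfiable). The incidence graph of $(F_i)_{i\in I}$ is the bipartite graph with parts $\bigcup_i\mathrm{var}(F_i)$ and $I$, with an edge $v$–$i$ iff $v\in\mathrm{var}(F_i)$; the family is acyclic if this graph has no cycle. -}

module Defs where

open import Data.Nat using (ℕ; suc)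
open import Data.Nat.DivMod using (_mod_)
open import Data.Bool using (Bool; true; false; not)
open import Data.Bool.Properties using () renaming (_≟_ to _≟ᵇ_)
open import Data.Nat.Properties using () renaming (_≟_ to _≟ℕ_)
open import Data.Fin using (Fin; toℕ)
open import Data.Product using (_×_; _,_; proj₁; proj₂; Σ; ∃)
open import Data.Product.Properties using (≡-dec)
open import Data.List using (List; filter; map; concat; tabulate)
open import Data.List.Relation.Unary.All using (All)
open import Data.List.Relation.Unary.Any using (Any)
open import Relation.Nullary using (¬_; ¬?)
open import Relation.Binary.PropositionalEquality using (_≡_)
open import Relation.Binary.Definitions using (DecidableEquality)
open import Function.Definitions using (Injective)

-- Variables are natural numbers; a literal is (variable , sign),
-- sign true = positive literal v, sign false = negative literal ¬v.
Var : Set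
Var = ℕ

Lit : Set
Lit = Var × Bool

var : Lit → Var
var = proj₁

compl : Lit → Lit
compl (v , s) = (v , not s)

_≟L_ : DecidableEquality Lit
_≟L_ = ≡-dec _≟ℕ_ _≟ᵇ_

open import Data.List.Membership.DecPropositional _≟L_ using (_∈_; _∈?_) public

Clause : Set
Clause = List Lit

ClauseSet : Set
ClauseSet = List Clause

NoComplPair : Clause → Set
NoComplPair C = All (λ x → ¬ (compl x ∈ C)) C

-- A clause-set in the paper's sense: all its clauses have no complementary pair.
WellFormed : ClauseSet → Set
WellFormed F = All NoComplPair F

Assignment : Set
Assignment = Var → Bool

evalLit : Assignment → Lit → Bool
evalLit β (v , true)  = β v
evalLit β (v , false) = not (β v)

Satisfies : Assignment → ClauseSet → Set
Satisfies β F = All (λ C → Any (λ x → evalLit β x ≡ true) C) F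

Satisfiable : ClauseSet → Set
Satisfiable F = ∃ λ β → Satisfies β F

Unsatisfiable : ClauseSet → Set
Unsatisfiable F = ¬ Satisfiable F

-- ⟨x → 0⟩ * F : set literal x to false: remove the clauses containing
-- the complement of x (now satisfied), and remove x from the remaining clauses.
assign0 : Lit → ClauseSet → ClauseSet
assign0 x F = map (filter (λ y → ¬? (y ≟L x)))
                  (filter (λ C → ¬? (compl x ∈? C)) F)

_∈frl_ : Lit → ClauseSet → Set
x ∈frl F = Unsatisfiable (assign0 x F)

_∈var_ : Var → ClauseSet → Set
v ∈var F = Any (λ C → Any (λ x → var x ≡ v) C) F

⋃ : ∀ {n} → (Fin n → ClauseSet) → ClauseSet
⋃ F = concat (tabulate F)

-- A cycle in the incidence graph of (F i)_{i ∈ Fin n}: a closed walk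
-- v₀ - i₀ - v₁ - i₁ - … - v_{k-1} - i_{k-1} - v₀ with k ≥ 2 (k = 2 + m),
-- pairwise distinct variable vertices and pairwise distinct index vertices,
-- where v_j ∈ var(F i_j) and v_{j+1 mod k} ∈ var(F i_j).
record IncidenceCycle {n : ℕ} (F : Fin n → ClauseSet) : Set where
  field
    m      : ℕ
    vs     : Fin (suc (suc m)) → Var
    is     : Fin (suc (suc m)) → Fin n
    vs-inj : Injective _≡_ _≡_ vs
    is-inj : Injective _≡_ _≡_ is
    left   : ∀ j → vs j ∈var F (is j)
    right  : ∀ j → vs (suc (toℕ j) mod suc (suc m)) ∈var F (is j)

Acyclic : ∀ {n} → (Fin n → ClauseSet) → Set
Acyclic F = ¬ IncidenceCycle F

module Submission where

-- A literal x is forced in F iff no model of F makes x false, so "F has no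
-- forced literal" says that every literal is false in some model of F; as
-- frl is defined negatively, all such existence claims live under ¬¬.
-- The proof is by induction on the size of the family:
--   1. ⟨x→0⟩*F is satisfiable iff F has a model falsifying x.
--   2. Gluing: if G and H have no forced literal and share at most one
--      variable, then G ∪ H has none (models of G and H can be chosen to
--      agree on the shared variable, and then combined).
--   3. Leaves: a nonempty acyclic family has a member sharing at most one
--      variable with the union of the others.  Otherwise every member can
--      be left through a shared variable other than the one it was entered
--      by; this infinite non-backtracking walk in the incidence graph closes
--      a cycle at its first repeated vertex.
--   4. Removing a leaf keeps the family acyclic; induction and 2 conclude.

open import Defs
open import Data.Nat using (ℕ; zero; suc; _+_; _<_; s≤s; anyUpTo?)
open import Data.Nat.Properties
  using (suc-injective; +-suc; +-identityʳ; +-cancelʳ-≡; +-monoˡ-<; m≤n+m;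
         ≤-<-trans; <-irrefl; <⇒≢; n<1+n; m<1+n⇒m<n∨m≡n)
  renaming (_≟_ to _≟ℕ_)
open import Data.Nat.DivMod using (_mod_; m%n<n; m<n⇒m%n≡m; n%n≡0)
open import Data.Bool using (true; false; not)
open import Data.Fin using (Fin; toℕ; punchIn) renaming (_≟_ to _≟ᶠ_)
import Data.Fin as Fin
open import Data.Fin.Properties
  using (toℕ-injective; toℕ<n; toℕ-fromℕ<; pigeonhole;
         punchIn-injective; punchInᵢ≢i; punchIn-punchOut)
open import Data.Product using (_×_; _,_; proj₁; proj₂; ∃)
open import Data.Sum using (_⊎_; inj₁; inj₂)
open import Data.List using ([]; _++_; filter; tabulate)
open import Data.List.Relation.Unary.All as All using (All)
import Data.List.Relation.Unary.All.Properties as AllP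
open import Data.List.Relation.Unary.Any as Any using (Any; any?)
import Data.List.Relation.Unary.Any.Properties as AnyP
open import Data.List.Relation.Binary.Subset.Propositional using (_⊆_)
open import Data.List.Membership.Propositional using (find; lose)
open import Data.List.Membership.Propositional.Properties using (∈-filter⁻)
open import Relation.Nullary using (¬_; ¬?; Dec; yes; no)
open import Relation.Nullary.Negation using (contradiction; ¬¬-map)
open import Relation.Nullary.Decidable using (decidable-stable; ¬¬-excluded-middle)
open import Relation.Binary.PropositionalEquality
  using (_≡_; _≢_; refl; sym; trans; cong; subst)
open import Data.Empty using (⊥-elim)
open import Function using (_∘_)

ClauseTrue : Assignment → Clause → Set
ClauseTrue β C = Any (λ y → evalLit β y ≡ true) C

FalsifyingModel : Lit → ClauseSet → Set
FalsifyingModel x F = ∃ λ β → evalLit β x ≡ false × Satisfies β F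

dropLit : Lit → Clause → Clause
dropLit x = filter (λ y → ¬? (y ≟L x))

dropLit-true : ∀ β x {C} → evalLit β x ≡ false → ClauseTrue β C → ClauseTrue β (dropLit x C)
dropLit-true β x x-false t with AnyP.filter⁺ (λ y → ¬? (y ≟L x)) t
... | inj₁ t′ = t′
... | inj₂ ¬y≢x = contradiction true-literal-≢x ¬y≢x
  where
  true-literal-≢x : Any.lookup t ≢ x
  true-literal-≢x refl with trans (sym (AnyP.lookup-result t)) x-false
  ... | ()

falsifyingModel⇒assign0-sat : ∀ x F → FalsifyingModel x F → Satisfiable (assign0 x F)
falsifyingModel⇒assign0-sat x F (β , x-false , sat) =
  β , AllP.map⁺ (All.map (dropLit-true β x x-false) (AllP.filter⁺ _ sat))

evalLit-agree : ∀ {β γ} y → β (var y) ≡ γ (var y) → evalLit β y ≡ evalLit γ y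
evalLit-agree (v , true)  e = e
evalLit-agree (v , false) e = cong not e

falsify : Lit → Assignment → Assignment
falsify (u , s) β v with v ≟ℕ u
... | yes _ = not s
... | no _  = β v

falsify-var : ∀ x β → falsify x β (var x) ≡ not (proj₂ x)
falsify-var (u , s) β with u ≟ℕ u
... | yes _ = refl
... | no u≢u = contradiction refl u≢u

falsify-x : ∀ x β → evalLit (falsify x β) x ≡ false
falsify-x (u , true)  β = falsify-var (u , true) β
falsify-x (u , false) β = cong not (falsify-var (u , false) β)

falsify-compl : ∀ x β → evalLit (falsify x β) (compl x) ≡ true
falsify-compl (u , true)  β = cong not (falsify-var (u , true) β)
falsify-compl (u , false) β = falsify-var (u , false) β

falsify-elsewhere : ∀ x β {v} → v ≢ var x → falsify x β v ≡ β v
falsify-elsewhere (u , s) β {v} v≢u with v ≟ℕ u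
... | yes v≡u = contradiction v≡u v≢u
... | no _    = refl

sameVar : ∀ x y → var y ≡ var x → y ≡ x ⊎ y ≡ compl x
sameVar (u , true)  (.u , true)  refl = inj₁ refl
sameVar (u , true)  (.u , false) refl = inj₂ refl
sameVar (u , false) (.u , true)  refl = inj₂ refl
sameVar (u , false) (.u , false) refl = inj₁ refl

restoreClause : ∀ β x {C} → ¬ compl x ∈ C → ClauseTrue β (dropLit x C) →
  ClauseTrue (falsify x β) C
restoreClause β x compl∉C t with find t
... | y , y∈dropped , y-true with ∈-filter⁻ (λ y → ¬? (y ≟L x)) y∈dropped
...   | y∈C , y≢x = lose y∈C (trans (evalLit-agree y (falsify-elsewhere x β otherVar)) y-true)
  where
  otherVar : var y ≢ var x
  otherVar same with sameVar x y same
  ... | inj₁ y≡x = y≢x y≡x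
  ... | inj₂ refl = compl∉C y∈C

assign0-sat⇒falsifyingModel : ∀ x F → Satisfiable (assign0 x F) → FalsifyingModel x F
assign0-sat⇒falsifyingModel x F (β , sat) =
  falsify x β , falsify-x x β , AllP.filter⁻ kept? keptTrue removedTrue
  where
  kept? = λ C → ¬? (compl x ∈? C)
  keptTrue : All (ClauseTrue (falsify x β)) (filter kept? F)
  keptTrue = All.zipWith (λ (compl∉C , t) → restoreClause β x compl∉C t)
                         (AllP.all-filter kept? F , AllP.map⁻ sat)
  -- the clauses removed by ⟨x→0⟩ contain the complement of x
  removedTrue : All (ClauseTrue (falsify x β)) (filter (¬? ∘ kept?) F)
  removedTrue = All.map (λ {C} ¬¬compl∈C →
                  lose (decidable-stable (compl x ∈? C) ¬¬compl∈C) (falsify-compl x β))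
                (AllP.all-filter (¬? ∘ kept?) F)

NoForcedLit : ClauseSet → Set
NoForcedLit F = ∀ x → ¬ ¬ FalsifyingModel x F

frl-empty⇒noForcedLit : ∀ F → (∀ x → ¬ x ∈frl F) → NoForcedLit F
frl-empty⇒noForcedLit F notForced x = ¬¬-map (assign0-sat⇒falsifyingModel x F) (notForced x)

noForcedLit⇒frl-empty : ∀ F → NoForcedLit F → ∀ x → ¬ x ∈frl F
noForcedLit⇒frl-empty F noForced x = ¬¬-map (falsifyingModel⇒assign0-sat x F) (noForced x)

noForcedLit-[] : NoForcedLit []
noForcedLit-[] (u , s) k = k ((λ _ → not s) , falsified s , All.[])
  where
  falsified : ∀ s → evalLit (λ _ → not s) (u , s) ≡ false
  falsified true  = refl
  falsified false = refl

noForcedLit-⊆ : ∀ {G F} → G ⊆ F → NoForcedLit F → NoForcedLit G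
noForcedLit-⊆ G⊆F noForced x = ¬¬-map (λ (β , x-false , sat) → β , x-false , AllP.anti-mono G⊆F sat)
                                       (noForced x)

someModel : ∀ {F} → NoForcedLit F → ¬ ¬ Satisfiable F
someModel noForced = ¬¬-map (λ (β , _ , sat) → β , sat) (noForced (0 , true))

_∈var?_ : ∀ v F → Dec (v ∈var F)
v ∈var? F = any? (any? (λ y → var y ≟ℕ v)) F

satisfies-agree : ∀ {β γ} F → (∀ {v} → v ∈var F → β v ≡ γ v) → Satisfies β F → Satisfies γ F
satisfies-agree {β} {γ} F agree sat =
  All.tabulate λ C∈F → clause-agree (λ v∈C → agree (Any.map (λ { refl → v∈C }) C∈F))
                                    (All.lookup sat C∈F)
  where
  clause-agree : ∀ {C} → (∀ {v} → Any (λ y → var y ≡ v) C → β v ≡ γ v) →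
    ClauseTrue β C → ClauseTrue γ C
  clause-agree agreeC t with find t
  ... | y , y∈C , y-true =
    lose y∈C (trans (sym (evalLit-agree y (agreeC (Any.map (λ { refl → refl }) y∈C)))) y-true)

SharesAtMostOne : ClauseSet → ClauseSet → Set
SharesAtMostOne G H = ∀ {v w} → v ∈var G → v ∈var H → w ∈var G → w ∈var H → v ≡ w

sharesAtMostOne-sym : ∀ {G H} → SharesAtMostOne G H → SharesAtMostOne H G
sharesAtMostOne-sym share v∈H v∈G w∈H w∈G = share v∈G v∈H w∈G w∈H

glue : ClauseSet → Assignment → Assignment → Assignment
glue G βG βH v with v ∈var? G
... | yes _ = βG v
... | no _  = βH v

glue-left : ∀ G βG βH {v} → v ∈var G → glue G βG βH v ≡ βG v
glue-left G βG βH {v} v∈G with v ∈var? G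
... | yes _ = refl
... | no v∉G = contradiction v∈G v∉G

glue-right : ∀ G βG βH {v} → ¬ v ∈var G → glue G βG βH v ≡ βH v
glue-right G βG βH {v} v∉G with v ∈var? G
... | yes v∈G = contradiction v∈G v∉G
... | no _ = refl

glue-sat : ∀ G H {βG βH} → Satisfies βG G → Satisfies βH H →
  (∀ {v} → v ∈var G → v ∈var H → βG v ≡ βH v) → Satisfies (glue G βG βH) (G ++ H)
glue-sat G H {βG} {βH} satG satH agree =
  AllP.++⁺ (satisfies-agree G (sym ∘ glue-left G βG βH) satG)
           (satisfies-agree H agreeH satH)
  where
  agreeH : ∀ {v} → v ∈var H → βH v ≡ glue G βG βH v
  agreeH {v} v∈H with v ∈var? G
  ... | yes v∈G = sym (agree v∈G v∈H)
  ... | no _ = refl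

falsified-opposite : ∀ β w b → evalLit β (w , not b) ≡ false → β w ≡ b
falsified-opposite β w false e = e
falsified-opposite β w true  e with β w | e
... | true | _ = refl

agreeingModel : ∀ A H → NoForcedLit H → SharesAtMostOne A H → (α : Assignment) →
  ¬ ¬ (∃ λ β → Satisfies β H × (∀ {v} → v ∈var A → v ∈var H → α v ≡ β v))
agreeingModel A H noForced share α k =
  ¬¬-excluded-middle {A = ∃ λ w → w ∈var A × w ∈var H} λ
    { (yes (w , w∈A , w∈H)) → noForced (w , not (α w)) λ (β , w-false , sat) →
        k (β , sat , λ v∈A v∈H → subst (λ u → α u ≡ β u) (sym (share v∈A v∈H w∈A w∈H))
                                       (sym (falsified-opposite β w (α w) w-false)))
    ; (no noneShared) → someModel noForced λ (β , sat) →
        k (β , sat , λ v∈A v∈H → contradiction (_ , v∈A , v∈H) noneShared) }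

-- Gluing: make x false in the part containing its variable, then extend
-- by an agreeing model of the other part.
union-noForcedLit : ∀ G H → NoForcedLit G → NoForcedLit H → SharesAtMostOne G H →
  NoForcedLit (G ++ H)
union-noForcedLit G H noForcedG noForcedH share x k with var x ∈var? G
... | yes x∈G = noForcedG x λ (βG , x-false , satG) →
  agreeingModel G H noForcedH share βG λ (βH , satH , agree) →
  k (glue G βG βH , trans (evalLit-agree x (glue-left G βG βH x∈G)) x-false ,
     glue-sat G H satG satH agree)
... | no x∉G = noForcedH x λ (βH , x-false , satH) →
  agreeingModel H G noForcedG (sharesAtMostOne-sym share) βH λ (βG , satG , agree) →
  k (glue G βG βH , trans (evalLit-agree x (glue-right G βG βH x∉G)) x-false ,
     glue-sat G H satG satH (λ v∈G v∈H → sym (agree v∈H v∈G)))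

InjectiveBelow : {A : Set} → (ℕ → A) → ℕ → Set
InjectiveBelow f t = ∀ {a b} → a < t → b < t → f a ≡ f b → a ≡ b

module _ {A : Set} {f : ℕ → A} where

  injectiveBelow-extend : ∀ {t} → InjectiveBelow f t → ¬ (∃ λ s → s < t × f s ≡ f t) →
    InjectiveBelow f (suc t)
  injectiveBelow-extend inj fresh a<1+t b<1+t e
    with m<1+n⇒m<n∨m≡n a<1+t | m<1+n⇒m<n∨m≡n b<1+t
  ... | inj₁ a<t  | inj₁ b<t  = inj a<t b<t e
  ... | inj₁ a<t  | inj₂ refl = contradiction (_ , a<t , e) fresh
  ... | inj₂ refl | inj₁ b<t  = contradiction (_ , b<t , sym e) fresh
  ... | inj₂ refl | inj₂ refl = refl

  injectiveBelow-tail : ∀ {t} → InjectiveBelow f (suc t) → InjectiveBelow (f ∘ suc) t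
  injectiveBelow-tail inj a<t b<t e = suc-injective (inj (s≤s a<t) (s≤s b<t) e)

  injectiveBelow-shift : ∀ {s K} → InjectiveBelow f (K + s) → InjectiveBelow (λ a → f (a + s)) K
  injectiveBelow-shift {s} inj a<K b<K e =
    +-cancelʳ-≡ s _ _ (inj (+-monoˡ-< s a<K) (+-monoˡ-< s b<K) e)

  inner≢start : ∀ {s K c} → InjectiveBelow f (K + s) → suc (c + s) < K + s →
    f (suc (c + s)) ≢ f s
  inner≢start {s} {K} {c} inj c-in same =
    <-irrefl (sym (inj c-in (≤-<-trans (m≤n+m s (suc c)) c-in) same)) (s≤s (m≤n+m s c))

  injectiveBelow-rotate : ∀ {s K} → InjectiveBelow f (K + s) → f s ≡ f (K + s) →
    InjectiveBelow (λ a → f (suc (a + s))) K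
  injectiveBelow-rotate {s} {K} inj repeat {a} {b} a<K b<K e
    with m<1+n⇒m<n∨m≡n (s≤s (+-monoˡ-< s a<K)) | m<1+n⇒m<n∨m≡n (s≤s (+-monoˡ-< s b<K))
  ... | inj₁ a-in  | inj₁ b-in  = +-cancelʳ-≡ s _ _ (suc-injective (inj a-in b-in e))
  ... | inj₁ a-in  | inj₂ b-end =
    contradiction (trans e (trans (cong f b-end) (sym repeat))) (inner≢start inj a-in)
  ... | inj₂ a-end | inj₁ b-in  =
    contradiction (trans (sym e) (trans (cong f a-end) (sym repeat))) (inner≢start inj b-in)
  ... | inj₂ a-end | inj₂ b-end = +-cancelʳ-≡ s _ _ (suc-injective (trans a-end (sym b-end)))

distance≥2 : ∀ {s t} → s < t → t ≢ suc s → ∃ λ m → t ≡ suc (suc m) + s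
distance≥2 {zero}  {suc zero}    _ t≢1 = contradiction refl t≢1
distance≥2 {zero}  {suc (suc m)} _ _   = m , cong (suc ∘ suc) (sym (+-identityʳ m))
distance≥2 {suc s} {suc t} (s≤s s<t) t≢s+2 with distance≥2 s<t (t≢s+2 ∘ cong suc)
... | m , refl = m , cong (suc ∘ suc) (sym (+-suc m s))

¬injectiveBelow-suc : ∀ {N} (f : ℕ → Fin N) → ¬ InjectiveBelow f (suc N)
¬injectiveBelow-suc {N} f inj with pigeonhole (n<1+n N) (f ∘ toℕ)
... | a , b , a<b , same = <⇒≢ a<b (inj (toℕ<n a) (toℕ<n b) same)

module _ {N : ℕ} (F : Fin N → ClauseSet) where

  closedWalk⇒cycle : ∀ m (vs : ℕ → Var) (is : ℕ → Fin N) →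
    InjectiveBelow vs (suc (suc m)) → InjectiveBelow is (suc (suc m)) →
    (∀ a → vs a ∈var F (is a)) → (∀ a → vs (suc a) ∈var F (is a)) →
    vs 0 ∈var F (is (suc m)) → IncidenceCycle F
  closedWalk⇒cycle m vs is vs-inj is-inj enter leave close = record
    { m      = m
    ; vs     = vs ∘ toℕ
    ; is     = is ∘ toℕ
    ; vs-inj = toℕ-injective ∘ vs-inj (toℕ<n _) (toℕ<n _)
    ; is-inj = toℕ-injective ∘ is-inj (toℕ<n _) (toℕ<n _)
    ; left   = enter ∘ toℕ
    ; right  = λ j → successor (toℕ j) (toℕ<n j)
    }
    where
    K = suc (suc m)
    successor : ∀ a → a < K → vs (toℕ (suc a mod K)) ∈var F (is a)
    successor a a<K rewrite toℕ-fromℕ< (m%n<n (suc a) K) with m<1+n⇒m<n∨m≡n (s≤s a<K)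
    ... | inj₁ a+1<K rewrite m<n⇒m%n≡m a+1<K = leave a
    ... | inj₂ refl  = subst (λ r → vs r ∈var F (is a)) (sym (n%n≡0 K)) close

  record Walk : Set where
    field
      idx      : ℕ → Fin N
      out      : ℕ → Var
      out-here : ∀ k → out k ∈var F (idx k)
      out-next : ∀ k → out k ∈var F (idx (suc k))
      idx-step : ∀ k → idx (suc k) ≢ idx k
      out-step : ∀ k → out (suc k) ≢ out k

  module _ (walk : Walk) where
    open Walk walk

    windowCycle : ∀ s m →
      InjectiveBelow (λ a → out (a + s)) (suc (suc m)) →
      InjectiveBelow (λ a → idx (suc (a + s))) (suc (suc m)) →
      out s ∈var F (idx (suc (suc m) + s)) → IncidenceCycle F
    windowCycle s m out-inj idx-inj =
      closedWalk⇒cycle m (λ a → out (a + s)) (λ a → idx (suc (a + s))) out-inj idx-inj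
        (λ a → out-next (a + s)) (λ a → out-here (suc (a + s)))

    NoRepeat : ℕ → Set
    NoRepeat t = InjectiveBelow idx t × InjectiveBelow out t

    closeAtMember : ∀ {s t} → s < t → idx s ≡ idx t → NoRepeat t → IncidenceCycle F
    closeAtMember {s} s<t same (idx-inj , out-inj)
      with distance≥2 s<t (λ { refl → idx-step s (sym same) })
    ... | m , refl = windowCycle s m (injectiveBelow-shift out-inj)
                       (injectiveBelow-rotate idx-inj same)
                       (subst (out s ∈var_ ∘ F) same (out-here s))

    closeAtVariable : ∀ {s t} → s < t → out s ≡ out t →
      InjectiveBelow idx (suc t) → InjectiveBelow out t → IncidenceCycle F
    closeAtVariable {s} {t} s<t same idx-inj out-inj
      with distance≥2 s<t (λ { refl → out-step s (sym same) })
    ... | m , refl = windowCycle s m (injectiveBelow-shift out-inj)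
                       (injectiveBelow-shift (injectiveBelow-tail idx-inj))
                       (subst (_∈var F (idx t)) (sym same) (out-here t))

    closeOrExtend : ∀ t → NoRepeat t → IncidenceCycle F ⊎ NoRepeat (suc t)
    closeOrExtend t (idx-inj , out-inj)
      with anyUpTo? (λ s → idx s ≟ᶠ idx t) t | anyUpTo? (λ s → out s ≟ℕ out t) t
    ... | yes (s , s<t , same) | _ = inj₁ (closeAtMember s<t same (idx-inj , out-inj))
    ... | no idx-fresh | yes (s , s<t , same) =
      inj₁ (closeAtVariable s<t same (injectiveBelow-extend idx-inj idx-fresh) out-inj)
    ... | no idx-fresh | no out-fresh =
      inj₂ (injectiveBelow-extend idx-inj idx-fresh , injectiveBelow-extend out-inj out-fresh)

    cycleOrNoRepeat : ∀ t → IncidenceCycle F ⊎ NoRepeat t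
    cycleOrNoRepeat zero = inj₂ ((λ ()) , (λ ()))
    cycleOrNoRepeat (suc t) with cycleOrNoRepeat t
    ... | inj₁ cycle = inj₁ cycle
    ... | inj₂ noRepeat = closeOrExtend t noRepeat

    -- A walk cannot visit N+1 distinct members, so it closes a cycle.
    walk⇒cycle : IncidenceCycle F
    walk⇒cycle with cycleOrNoRepeat (suc N)
    ... | inj₁ cycle = cycle
    ... | inj₂ (idx-inj , _) = ⊥-elim (¬injectiveBelow-suc idx idx-inj)

Rest : ∀ {n} → (Fin (suc n) → ClauseSet) → Fin (suc n) → Fin n → ClauseSet
Rest F i = F ∘ punchIn i

acyclic-rest : ∀ {n} (F : Fin (suc n) → ClauseSet) i → Acyclic F → Acyclic (Rest F i)
acyclic-rest F i acyclic cycle = acyclic record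
  { m = m ; vs = vs ; is = punchIn i ∘ is ; vs-inj = vs-inj
  ; is-inj = is-inj ∘ punchIn-injective i _ _ ; left = left ; right = right }
  where open IncidenceCycle cycle

⋃-split : ∀ {n} (F : Fin (suc n) → ClauseSet) i → ⋃ F ⊆ F i ++ ⋃ (Rest F i)
⋃-split F i C∈⋃F with AnyP.tabulate⁻ (AnyP.concat⁻ (tabulate F) C∈⋃F)
... | j , C∈Fj with i ≟ᶠ j
...   | yes refl = AnyP.++⁺ˡ C∈Fj
...   | no i≢j = AnyP.++⁺ʳ (F i) (AnyP.concat⁺ (AnyP.tabulate⁺ (Fin.punchOut i≢j)
                   (subst (λ k → Any (_ ≡_) (F k)) (sym (punchIn-punchOut i≢j)) C∈Fj)))

record SharedElsewhere {N} (F : Fin N → ClauseSet) (i : Fin N) (v : Var) : Set where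
  field
    inHere  : v ∈var F i
    other   : Fin N
    other≢i : other ≢ i
    inOther : v ∈var F other

record Branching {N} (F : Fin N → ClauseSet) (i : Fin N) : Set where
  field
    p q      : Var
    p≢q      : p ≢ q
    p-shared : SharedElsewhere F i p
    q-shared : SharedElsewhere F i q

leaf⇒sharesAtMostOne : ∀ {n} (F : Fin (suc n) → ClauseSet) i → ¬ Branching F i →
  SharesAtMostOne (F i) (⋃ (Rest F i))
leaf⇒sharesAtMostOne F i leaf {v} {w} v∈Fi v∈rest w∈Fi w∈rest with v ≟ℕ w
... | yes v≡w = v≡w
... | no v≢w = contradiction (record { p = v ; q = w ; p≢q = v≢w
                                      ; p-shared = shared v∈Fi v∈rest
                                      ; q-shared = shared w∈Fi w∈rest }) leaf
  where
  shared : ∀ {u} → u ∈var F i → u ∈var ⋃ (Rest F i) → SharedElsewhere F i u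
  shared u∈Fi u∈rest with AnyP.tabulate⁻ (AnyP.concat⁻ (tabulate (Rest F i)) u∈rest)
  ... | j , u∈Fj = record { inHere = u∈Fi ; other = punchIn i j
                          ; other≢i = punchInᵢ≢i i j ; inOther = u∈Fj }

-- If every member branches, always leaving through a shared variable other
-- than the entering one gives a non-backtracking walk.
branchingWalk : ∀ {n} (F : Fin (suc n) → ClauseSet) → (∀ i → Branching F i) → Walk F
branchingWalk {n} F branch = record
  { idx = proj₁ ∘ position ; out = exit ∘ position
  ; out-here = inHere ∘ exit-shared ∘ position
  ; out-next = inOther ∘ exit-shared ∘ position
  ; idx-step = other≢i ∘ exit-shared ∘ position
  ; out-step = exit-≢ ∘ position ∘ suc }
  where
  open Branching
  open SharedElsewhere
  -- a member together with the variable through which it was entered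
  State = Fin (suc n) × Var

  exit : State → Var
  exit (j , v) with p (branch j) ≟ℕ v
  ... | yes _ = q (branch j)
  ... | no _  = p (branch j)

  exit-≢ : ∀ st → exit st ≢ proj₂ st
  exit-≢ (j , v) with p (branch j) ≟ℕ v
  ... | yes p≡v = λ q≡v → p≢q (branch j) (trans p≡v (sym q≡v))
  ... | no p≢v  = p≢v

  exit-shared : ∀ st → SharedElsewhere F (proj₁ st) (exit st)
  exit-shared (j , v) with p (branch j) ≟ℕ v
  ... | yes _ = q-shared (branch j)
  ... | no _  = p-shared (branch j)

  position : ℕ → State
  position zero    = Fin.zero , q (branch Fin.zero)
  position (suc k) = other (exit-shared (position k)) , exit (position k)

¬¬-∀Fin : ∀ n {P : Fin n → Set} → (∀ i → ¬ ¬ P i) → ¬ ¬ (∀ i → P i)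
¬¬-∀Fin zero    _ k = k (λ ())
¬¬-∀Fin (suc n) {P} h k =
  h Fin.zero λ p₀ → ¬¬-∀Fin n {P ∘ Fin.suc} (h ∘ Fin.suc) λ ps →
  k λ { Fin.zero → p₀ ; (Fin.suc i) → ps i }

leafExists : ∀ {n} (F : Fin (suc n) → ClauseSet) → Acyclic F →
  ¬ ¬ (∃ λ i → ¬ Branching F i)
leafExists {n} F acyclic noLeaf =
  ¬¬-∀Fin (suc n) (λ i notBranching → noLeaf (i , notBranching))
    λ branch → acyclic (walk⇒cycle F (branchingWalk F branch))

-- Induction on the size of the family: split off a leaf and glue it back.
noForcedLit-⋃ : ∀ n (F : Fin n → ClauseSet) → Acyclic F → (∀ i → NoForcedLit (F i)) →
  NoForcedLit (⋃ F)
noForcedLit-⋃ zero    F _       _        = noForcedLit-[]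
noForcedLit-⋃ (suc n) F acyclic noForced x k = leafExists F acyclic λ (i , leaf) →
  noForcedLit-⊆ (⋃-split F i)
    (union-noForcedLit (F i) (⋃ (Rest F i)) (noForced i)
       (noForcedLit-⋃ n (Rest F i) (acyclic-rest F i acyclic) (noForced ∘ punchIn i))
       (leaf⇒sharesAtMostOne F i leaf))
    x k

-- The clause-sets need not be well formed for this argument.
lemma4p13 : (n : ℕ) (F : Fin n → ClauseSet) →
    (∀ i → WellFormed (F i)) →
    Acyclic F →
    (∀ i (x : Lit) → ¬ (x ∈frl F i)) →
    ∀ (x : Lit) → ¬ (x ∈frl ⋃ F)
lemma4p13 n F _ acyclic notForced =
  noForcedLit⇒frl-empty (⋃ F)
    (noForcedLit-⋃ n F acyclic (λ i → frl-empty⇒noForcedLit (F i) (notForced i)))
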